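{- Let $t$ be an $\mathrm{SL}_2$-tiling and let $i<j$ be integers. Then $c_{ij}$ and $d_{ij}$ are positive integers.
   Context: An $\mathrm{SL}_2$-tiling is a map $t:\mathbb{Z}\times\mathbb{Z}\to\{1,2,3,\dots\}$, $(i,j)\mapsto t_{ij}$, with $t_{ij}t_{i+1,j+1}-t_{i,j+1}t_{i+1,j}=1$ for all $i,j$. For integers $i<j$ define $c_{ij}=t_{ia}t_{j,a+1}-t_{i,a+1}t_{ja}$ and $d_{ij}=t_{ai}t_{a+1,j}-t_{aj}t_{a+1,i}$, where $a$ is any integer; these values do not depend on the choice of $a$. -}

module Defs where

open import Data.Integer using (ℤ; _+_; _-_; _*_; _>_; 1ℤ; 0ℤ)
open import Relation.Binary.PropositionalEquality using (_≡_)

record SL2Tiling : Set where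
  field
    t        : ℤ → ℤ → ℤ
    positive : ∀ i j → t i j > 0ℤ
    unimod   : ∀ i j → t i j * t (i + 1ℤ) (j + 1ℤ) - t i (j + 1ℤ) * t (i + 1ℤ) j ≡ 1ℤ

open SL2Tiling public

-- c_{ij} computed with auxiliary column index a:
--   c_{ij} = t_{i a} t_{j,a+1} - t_{i,a+1} t_{j a}
c[_] : SL2Tiling → ℤ → ℤ → ℤ → ℤ
c[ T ] a i j = t T i a * t T j (a + 1ℤ) - t T i (a + 1ℤ) * t T j a

-- d_{ij} computed with auxiliary row index a:
--   d_{ij} = t_{a i} t_{a+1,j} - t_{a j} t_{a+1,i}
d[_] : SL2Tiling → ℤ → ℤ → ℤ → ℤ
d[ T ] a i j = t T a i * t T (a + 1ℤ) j - t T a j * t T (a + 1ℤ) i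

module Submission where

-- Fix two sequences u, v : ℤ → ℤ and write  W i j = u i v j − v i u j  for
-- their 2×2 minors (`minor u v i j` below).  Any such minors satisfy the three-term Plücker relation
--     u j · W i k  =  u k · W i j  +  u i · W j k .
-- Hence if u is positive and the adjacent minors W i (i+1) are positive,
-- induction on j − i shows W i j > 0 whenever i < j: taking k = j + 1, the
-- right-hand side is a sum of two positive terms, and the positive factor
-- u j can be cancelled on the left.
--
-- For an SL₂-tiling t and any a, c_{ij} is the minor of the two columns
-- t(−, a), t(−, a+1) and d_{ij} that of the two rows t(a, −), t(a+1, −);
-- in both cases the entries are positive and the adjacent minors equal 1
-- by unimodularity, so the general positivity result applies.

open import Defs
open import Data.Integer using (ℤ; +0; +[1+_]; +<+; _+_; _-_; _*_; -_; _<_; _>_; 0ℤ; 1ℤ)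
open import Data.Integer.Properties
open import Data.Integer.Tactic.RingSolver using (solve-∀)
open import Data.Nat using (zero; suc)
open import Data.Product using (_×_; _,_; ∃)
open import Relation.Binary.PropositionalEquality
open ≡-Reasoning

*-pos : ∀ {x y} → x > 0ℤ → y > 0ℤ → x * y > 0ℤ
*-pos {x} {y} x>0 y>0 =
  subst (_< x * y) (*-zeroʳ x) (*-monoˡ-<-pos x {{Data.Integer.positive x>0}} y>0)

*-cancelˡ-pos : ∀ {x y} → x > 0ℤ → x * y > 0ℤ → y > 0ℤ
*-cancelˡ-pos {x} {y} x>0 xy>0 =
  *-cancelˡ-<-nonNeg x {{Data.Integer.nonNegative (<⇒≤ x>0)}}
    (subst (_< x * y) (sym (*-zeroʳ x)) xy>0)

positive-form : ∀ d → d > 0ℤ → ∃ λ n → d ≡ +[1+ n ]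
positive-form +[1+ n ] _        = n , refl
positive-form +0       (+<+ ())

-- If i < j then j lies a positive number of unit steps beyond i; this turns
-- induction on the gap j − i into induction on ℕ.
positive-gap : ∀ {i j} → i < j → ∃ λ n → j ≡ i + +[1+ n ]
positive-gap {i} {j} i<j with positive-form (j - i) 0<j-i
  where
  0<j-i : j - i > 0ℤ
  0<j-i = subst (_< j - i) (+-inverseʳ i) (+-monoˡ-< (- i) i<j)
... | n , j-i≡n+1 = n , (begin
  j              ≡⟨ add-difference i j ⟩
  i + (j - i)    ≡⟨ cong (i +_) j-i≡n+1 ⟩
  i + +[1+ n ]   ∎)
  where
  add-difference : ∀ i j → j ≡ i + (j - i)
  add-difference = solve-∀

minor : (ℤ → ℤ) → (ℤ → ℤ) → ℤ → ℤ → ℤ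
minor u v i j = u i * v j - v i * u j

plücker : ∀ (u v : ℤ → ℤ) i j k →
          u j * minor u v i k ≡ u k * minor u v i j + u i * minor u v j k
plücker u v i j k = identity (u i) (u j) (u k) (v i) (v j) (v k)
  where
  identity : ∀ ui uj uk vi vj vk →
             uj * (ui * vk - vi * uk) ≡ uk * (ui * vj - vi * uj) + ui * (uj * vk - vj * uk)
  identity = solve-∀

module _ (u v : ℤ → ℤ) (u-pos : ∀ i → u i > 0ℤ)
         (adjacent-pos : ∀ i → minor u v i (i + 1ℤ) > 0ℤ) where

  minor-pos-step : ∀ i n → minor u v i (i + +[1+ n ]) > 0ℤ
  minor-pos-step i zero    = adjacent-pos i
  minor-pos-step i (suc n) = subst (λ k → minor u v i k > 0ℤ) (sym k≡j+1) W[i,j+1]>0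
    where
    j k : ℤ
    j = i + +[1+ n ]
    k = i + +[1+ suc n ]

    k≡j+1 : k ≡ j + 1ℤ
    k≡j+1 = begin
      i + (1ℤ + +[1+ n ])   ≡⟨ cong (i +_) (+-comm 1ℤ +[1+ n ]) ⟩
      i + (+[1+ n ] + 1ℤ)   ≡⟨ +-assoc i +[1+ n ] 1ℤ ⟨
      j + 1ℤ                ∎

    W[i,j+1]>0 : minor u v i (j + 1ℤ) > 0ℤ
    W[i,j+1]>0 = *-cancelˡ-pos (u-pos j)
      (subst (_> 0ℤ) (sym (plücker u v i j (j + 1ℤ)))
        (+-mono-< (*-pos (u-pos (j + 1ℤ)) (minor-pos-step i n))
                  (*-pos (u-pos i) (adjacent-pos j))))

  minor-pos : ∀ {i j} → i < j → minor u v i j > 0ℤ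
  minor-pos {i} i<j with positive-gap i<j
  ... | n , refl = minor-pos-step i n

unimodular-pos : ∀ {x} → x ≡ 1ℤ → x > 0ℤ
unimodular-pos x≡1 = subst (_> 0ℤ) (sym x≡1) (positive⁻¹ 1ℤ)

d-minor : ∀ T a i j → d[ T ] a i j ≡ minor (t T a) (t T (a + 1ℤ)) i j
d-minor T a i j = cong (_-_ (t T a i * t T (a + 1ℤ) j)) (*-comm (t T a j) (t T (a + 1ℤ) i))

proposition5p6 : (T : SL2Tiling) (i j : ℤ) → i < j →
    ∀ a → (c[ T ] a i j > 0ℤ) × (d[ T ] a i j > 0ℤ)
proposition5p6 T i j i<j a = c-pos , d-pos
  where
  c-pos : c[ T ] a i j > 0ℤ
  c-pos = minor-pos (λ x → t T x a) (λ x → t T x (a + 1ℤ)) (λ x → positive T x a)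
            (λ x → unimodular-pos (unimod T x a)) i<j

  d-pos : d[ T ] a i j > 0ℤ
  d-pos = subst (_> 0ℤ) (sym (d-minor T a i j))
            (minor-pos (t T a) (t T (a + 1ℤ)) (positive T a)
              (λ x → unimodular-pos (trans (sym (d-minor T a x (x + 1ℤ))) (unimod T a x))) i<j)
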